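{- Let $X$ be a finite set with $|X|=n\ge1$ and let $\mathcal{A}$ be an antichain of $2^X$. Then $$2|\mathcal{A}|+|\overline{\nabla}(\mathcal{A})|\le 2\binom{n}{\lfloor n/2\rfloor}+\binom{n}{\lfloor n/2\rfloor+1},$$ and this bound is tight (it is attained by some antichain of $2^X$).
   Context: An antichain of $2^X$ is a non-empty family of subsets of $X$ any two of which are incomparable under inclusion. For a family $\mathcal{A}\subseteq 2^X$, its shade is $\nabla(\mathcal{A})=\{B\subseteq X: \exists A\in\mathcal{A},\ A\subseteq B,\ |B|=|A|+1\}$, and $\overline{\nabla}(\mathcal{A})=\min(\nabla(\mathcal{A}))$ is the set of inclusion-minimal elements of $\nabla(\mathcal{A})$. -}

module Defs where

open import Data.Nat using (ℕ; suc)
open import Data.Fin.Subset using (Subset; _⊆_; ∣_∣)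
open import Data.List using (List; [])
open import Data.List.Membership.Propositional using (_∈_)
open import Data.List.Relation.Unary.Unique.Propositional using (Unique)
open import Data.Product using (Σ; _×_; ∃-syntax)
open import Relation.Binary.PropositionalEquality using (_≡_; _≢_)
open import Relation.Nullary using (¬_)

-- The ground set X is Fin n; a subset of X is a Subset n.
-- A finite family of subsets is represented by a duplicate-free list;
-- its cardinality is the length of the list.

record IsAntichain {n : ℕ} (𝒜 : List (Subset n)) : Set where
  field
    nonEmpty     : 𝒜 ≢ []
    noDup        : Unique 𝒜
    incomparable : ∀ {A B} → A ∈ 𝒜 → B ∈ 𝒜 → A ⊆ B → A ≡ B

_∈∇_ : {n : ℕ} → Subset n → List (Subset n) → Set
B ∈∇ 𝒜 = ∃[ A ] (A ∈ 𝒜 × A ⊆ B × ∣ B ∣ ≡ suc ∣ A ∣)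

-- Membership in min ∇(𝒜): inclusion-minimal elements of the shade.
_∈min∇_ : {n : ℕ} → Subset n → List (Subset n) → Set
B ∈min∇ 𝒜 = B ∈∇ 𝒜 × (∀ C → C ∈∇ 𝒜 → C ⊆ B → C ≡ B)

-- L enumerates min ∇(𝒜) exactly once each; then |min ∇(𝒜)| = length L.
record EnumeratesMinShade {n : ℕ} (𝒜 L : List (Subset n)) : Set where
  field
    noDup    : Unique L
    sound    : ∀ {B} → B ∈ L → B ∈min∇ 𝒜
    complete : ∀ {B} → B ∈min∇ 𝒜 → B ∈ L

module Submission where

-- Weight each subset S of X = Fin n by 2·[S ∈ 𝒜] + [S ∈ L],
-- where L enumerates min ∇(𝒜); the total weight is 2|𝒜| + |L|.  Both 𝒜 and
-- L are antichains, and they are disjoint since a member of an antichain is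
-- never in its shade.  Decompose 2^X into symmetric chains (de Bruijn,
-- Tengbergen, Kruyswijk).  A chain meets each antichain at most once, so its
-- weight is at most 2 + 1, and at most 2 if it has a single member.  Every
-- symmetric chain crosses level k = ⌊n/2⌋ once, and, if it has two or more
-- members, also level k+1; so its weight is at most that of the weighting
-- 2 on level k, 1 on level k+1.  Summing over the chains gives
-- 2|𝒜| + |L| ≤ 2·C(n,k) + C(n,k+1); the layer k attains it, its minimal
-- shade being the layer k+1.  The file develops: sums over lists and over
-- 2^X; indicators and multiplicities; the chain decomposition; the level
-- profile of a symmetric chain; the upper bound; the layers; the theorem.

open import Defs
open import Data.Nat using (ℕ; zero; suc; _+_; _*_; _≤_; _<_; _/_; _%_; z≤n; s≤s)
open import Data.Nat.Properties
open import Data.Nat.Combinatorics using (_C_; nCk+nC[k+1]≡[n+1]C[k+1])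
open import Data.Nat.DivMod using (m≡m%n+[m/n]*n; m%n<n; m/n≤m)
open import Data.Nat.Tactic.RingSolver using (solve-∀)
open import Data.Bool using (if_then_else_)
import Data.Bool.Properties as Bool
open import Data.Fin.Subset using (Subset; _⊆_; ∣_∣; inside; outside)
open import Data.Fin.Subset.Properties using (drop-∷-⊆; out⊆; s⊆s; p⊆q⇒∣p∣≤∣q∣)
open import Data.Vec using ([]; _∷_) renaming (here to vhere)
open import Data.Vec.Properties using (≡-dec)
open import Data.List using (List; []; _∷_; length; _++_; map; concatMap)
open import Data.List.Properties using (length-map; length-++; ∷-injectiveˡ; ∷-injectiveʳ)
open import Data.List.Membership.Propositional using (_∈_; _∉_)
open import Data.List.Membership.Propositional.Properties
  using (∈-map⁺; ∈-map⁻; ∈-++⁺ˡ; ∈-++⁺ʳ; ∈-++⁻)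
import Data.List.Membership.DecPropositional as DecMembership
open import Data.List.Relation.Unary.Any using (here; there)
open import Data.List.Relation.Unary.All using (All; []; _∷_)
import Data.List.Relation.Unary.All as All
open import Data.List.Relation.Unary.All.Properties using (All¬⇒¬Any; concat⁺) renaming (map⁺ to All-map⁺)
open import Data.List.Relation.Unary.AllPairs using (AllPairs; []; _∷_)
import Data.List.Relation.Unary.AllPairs as AllPairs
import Data.List.Relation.Unary.AllPairs.Properties as AllPairs
open import Data.List.Relation.Unary.Unique.Propositional using (Unique)
import Data.List.Relation.Unary.Unique.Propositional.Properties as Unique
open import Data.Product using (Σ; _×_; _,_; proj₁; proj₂; ∃-syntax)
open import Data.Sum using (_⊎_; inj₁; inj₂)
open import Data.Empty using (⊥-elim)
open import Data.Unit using (⊤; tt)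
open import Relation.Nullary using (¬_; yes; no; does)
open import Relation.Binary.Definitions using (DecidableEquality)
open import Relation.Binary.PropositionalEquality
open import Function using (id; case_of_)

interchange : ∀ a b c d → (a + b) + (c + d) ≡ (a + c) + (b + d)
interchange = solve-∀

double-plus : ∀ a b → 2 * a + b ≡ a + a + b
double-plus = solve-∀

listSum : {A : Set} → (A → ℕ) → List A → ℕ
listSum f []       = 0
listSum f (x ∷ xs) = f x + listSum f xs

listSum-++ : {A : Set} (f : A → ℕ) (xs ys : List A) →
  listSum f (xs ++ ys) ≡ listSum f xs + listSum f ys
listSum-++ f []       ys = refl
listSum-++ f (x ∷ xs) ys = trans (cong (f x +_) (listSum-++ f xs ys)) (sym (+-assoc (f x) _ _))

listSum-map : {A B : Set} (f : B → ℕ) (g : A → B) (xs : List A) →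
  listSum f (map g xs) ≡ listSum (λ x → f (g x)) xs
listSum-map f g []       = refl
listSum-map f g (x ∷ xs) = cong (f (g x) +_) (listSum-map f g xs)

listSum-+ : {A : Set} (f g : A → ℕ) (xs : List A) →
  listSum (λ x → f x + g x) xs ≡ listSum f xs + listSum g xs
listSum-+ f g []       = refl
listSum-+ f g (x ∷ xs) =
  trans (cong (f x + g x +_) (listSum-+ f g xs)) (interchange (f x) (g x) _ _)

listSum-double-plus : {A : Set} (f g : A → ℕ) (xs : List A) →
  listSum (λ x → f x + f x + g x) xs ≡ listSum f xs + listSum f xs + listSum g xs
listSum-double-plus f g xs =
  trans (listSum-+ (λ x → f x + f x) g xs) (cong (_+ listSum g xs) (listSum-+ f f xs))

listSum-mono : {A : Set} (f g : A → ℕ) (xs : List A) →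
  All (λ x → f x ≤ g x) xs → listSum f xs ≤ listSum g xs
listSum-mono f g []       []       = z≤n
listSum-mono f g (x ∷ xs) (p ∷ ps) = +-mono-≤ p (listSum-mono f g xs ps)

listSum-zero : {A : Set} (f : A → ℕ) (xs : List A) → All (λ x → f x ≡ 0) xs → listSum f xs ≡ 0
listSum-zero f []       []       = refl
listSum-zero f (x ∷ xs) (p ∷ ps) = cong₂ _+_ p (listSum-zero f xs ps)

out ins : ∀ {n} → Subset n → Subset (suc n)
out S = outside ∷ S
ins S = inside ∷ S

subsetSum : (n : ℕ) → (Subset n → ℕ) → ℕ
subsetSum zero    w = w []
subsetSum (suc n) w = subsetSum n (λ S → w (out S)) + subsetSum n (λ S → w (ins S))

subsetSum-+ : ∀ n (f g : Subset n → ℕ) →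
  subsetSum n (λ S → f S + g S) ≡ subsetSum n f + subsetSum n g
subsetSum-+ zero    f g = refl
subsetSum-+ (suc n) f g =
  trans (cong₂ _+_ (subsetSum-+ n (λ S → f (out S)) (λ S → g (out S)))
                   (subsetSum-+ n (λ S → f (ins S)) (λ S → g (ins S))))
        (interchange (subsetSum n (λ S → f (out S))) (subsetSum n (λ S → g (out S)))
                     (subsetSum n (λ S → f (ins S))) (subsetSum n (λ S → g (ins S))))

subsetSum-double-plus : ∀ n (f g : Subset n → ℕ) →
  subsetSum n (λ S → f S + f S + g S) ≡ subsetSum n f + subsetSum n f + subsetSum n g
subsetSum-double-plus n f g =
  trans (subsetSum-+ n (λ S → f S + f S) g) (cong (_+ subsetSum n g) (subsetSum-+ n f f))

subsetSum-zero : ∀ n (w : Subset n → ℕ) → (∀ S → w S ≡ 0) → subsetSum n w ≡ 0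
subsetSum-zero zero    w z = z []
subsetSum-zero (suc n) w z =
  cong₂ _+_ (subsetSum-zero n (λ S → w (out S)) (λ S → z (out S)))
            (subsetSum-zero n (λ S → w (ins S)) (λ S → z (ins S)))

subsetSum-point : ∀ n (w : Subset n → ℕ) T → (∀ S → S ≢ T → w S ≡ 0) → subsetSum n w ≡ w T
subsetSum-point zero    w [] z = refl
subsetSum-point (suc n) w (outside ∷ T) z =
  trans (cong₂ _+_ (subsetSum-point n (λ S → w (out S)) T (λ S S≢T → z (out S) (λ { refl → S≢T refl })))
                   (subsetSum-zero n (λ S → w (ins S)) (λ S → z (ins S) (λ ()))))
        (+-identityʳ (w (out T)))
subsetSum-point (suc n) w (inside ∷ T) z =
  cong₂ _+_ (subsetSum-zero n (λ S → w (out S)) (λ S → z (out S) (λ ())))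
            (subsetSum-point n (λ S → w (ins S)) T (λ S S≢T → z (ins S) (λ { refl → S≢T refl })))

module Indicator {A : Set} (_≟_ : DecidableEquality A) where

  δ : A → A → ℕ
  δ x y = if does (x ≟ y) then 1 else 0

  δ-refl : ∀ x → δ x x ≡ 1
  δ-refl x with x ≟ x
  ... | yes _  = refl
  ... | no x≢x = ⊥-elim (x≢x refl)

  δ-≢ : ∀ {x y} → x ≢ y → δ x y ≡ 0
  δ-≢ {x} {y} x≢y with x ≟ y
  ... | yes x≡y = ⊥-elim (x≢y x≡y)
  ... | no _    = refl

_≟ˢ_ : ∀ {n} → DecidableEquality (Subset n)
_≟ˢ_ = ≡-dec Bool._≟_

module SubsetIndicator {n : ℕ} = Indicator (_≟ˢ_ {n})
module SubsetMembership {n : ℕ} = DecMembership (_≟ˢ_ {n})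
open SubsetIndicator using () renaming (δ to δˢ; δ-refl to δˢ-refl; δ-≢ to δˢ-≢)
open SubsetMembership using (_∈?_)
open Indicator _≟_ using (δ; δ-refl; δ-≢)

-- The number of m-element subsets of Fin n is n C m (Pascal's rule).  In the
-- last clause δ (suc a) (suc b) computes to δ a b.
count-level : ∀ n m → subsetSum n (λ S → δ (∣ S ∣) m) ≡ n C m
count-level zero    zero    = refl
count-level zero    (suc m) = refl
count-level (suc n) zero    =
  trans (cong₂ _+_ (count-level n zero)
                   (subsetSum-zero n (λ S → δ (suc ∣ S ∣) zero) (λ S → δ-≢ {suc ∣ S ∣} {zero} (λ ()))))
        (+-identityʳ (n C zero))
count-level (suc n) (suc m) =
  trans (cong₂ _+_ (count-level n (suc m)) (count-level n m))
        (trans (+-comm (n C suc m) (n C m)) (nCk+nC[k+1]≡[n+1]C[k+1] n m))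

mult : ∀ {n} → Subset n → List (Subset n) → ℕ
mult S xs = listSum (δˢ S) xs

mult-total : ∀ n (xs : List (Subset n)) → subsetSum n (λ S → mult S xs) ≡ length xs
mult-total n []       = subsetSum-zero n (λ _ → 0) (λ _ → refl)
mult-total n (x ∷ xs) =
  trans (subsetSum-+ n (λ S → δˢ S x) (λ S → mult S xs))
        (cong₂ _+_ (trans (subsetSum-point n (λ S → δˢ S x) x (λ S → δˢ-≢)) (δˢ-refl x))
                   (mult-total n xs))

mult-∉ : ∀ {n} (S : Subset n) xs → S ∉ xs → mult S xs ≡ 0
mult-∉ S []       _   = refl
mult-∉ S (x ∷ xs) S∉ = cong₂ _+_ (δˢ-≢ (λ S≡x → S∉ (here S≡x))) (mult-∉ S xs (λ S∈ → S∉ (there S∈)))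

mult-≤1 : ∀ {n} (S : Subset n) {xs} → Unique xs → mult S xs ≤ 1
mult-≤1 S {[]} [] = z≤n
mult-≤1 S {x ∷ xs} (x∉xs ∷ u) with S ≟ˢ x
... | yes refl = s≤s (≤-reflexive (mult-∉ S xs (All¬⇒¬Any x∉xs)))
... | no _     = mult-≤1 S u

Incomparable : ∀ {n} → List (Subset n) → Set
Incomparable F = ∀ {A B} → A ∈ F → B ∈ F → A ⊆ B → A ≡ B

-- t ⊐ x: x lies strictly below t; chains are listed from the top down,
-- so a chain c satisfies AllPairs _⊐_ c.
_⊐_ : ∀ {n} → Subset n → Subset n → Set
t ⊐ x = x ⊆ t × ∣ x ∣ < ∣ t ∣

chain-meets-antichain : ∀ {n} {F : List (Subset n)} → Unique F → Incomparable F →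
  ∀ {c} → AllPairs _⊐_ c → listSum (λ S → mult S F) c ≤ 1
chain-meets-antichain u inc {[]} [] = z≤n
chain-meets-antichain {F = F} u inc {t ∷ r} (t⊐r ∷ desc) with t ∈? F
... | no t∉F =
  ≤-trans (≤-reflexive (cong (_+ _) (mult-∉ t F t∉F))) (chain-meets-antichain u inc desc)
... | yes t∈F =
  ≤-trans (≤-reflexive (trans (cong (mult t F +_) (listSum-zero _ r (All.map below-absent t⊐r)))
                              (+-identityʳ _)))
          (mult-≤1 t u)
  where
  below-absent : ∀ {x} → t ⊐ x → mult x F ≡ 0
  below-absent {x} (x⊆t , ∣x∣<∣t∣) =
    mult-∉ x F (λ x∈F → <-irrefl (cong ∣_∣ (inc x∈F t∈F x⊆t)) ∣x∣<∣t∣)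

-- The inductive step of the symmetric chain decomposition: a chain t ⊐ r of
-- subsets of Fin n yields the chain ins t ⊐ out t ⊐ out r, one level longer,
-- and the chain ins r, one level shorter and shifted up by one.
split : ∀ {n} → List (Subset n) → List (List (Subset (suc n)))
split []      = []
split (t ∷ r) = (ins t ∷ map out (t ∷ r)) ∷ map ins r ∷ []

chains : (n : ℕ) → List (List (Subset n))
chains zero    = ([] ∷ []) ∷ []
chains (suc n) = concatMap split (chains n)

split-sum : ∀ {n} (w : Subset (suc n) → ℕ) (c : List (Subset n)) →
  listSum (listSum w) (split c) ≡ listSum (λ S → w (out S)) c + listSum (λ S → w (ins S)) c
split-sum w []      = refl
split-sum w (t ∷ r) = begin
    (w (ins t) + listSum w (map out (t ∷ r))) + (listSum w (map ins r) + 0)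
  ≡⟨ cong₂ (λ a b → (w (ins t) + a) + (b + 0)) (listSum-map w out (t ∷ r)) (listSum-map w ins r) ⟩
    (w (ins t) + listSum (λ S → w (out S)) (t ∷ r)) + (listSum (λ S → w (ins S)) r + 0)
  ≡⟨ regroup (w (ins t)) _ _ ⟩
    listSum (λ S → w (out S)) (t ∷ r) + (w (ins t) + listSum (λ S → w (ins S)) r)
  ∎
  where
  open ≡-Reasoning
  regroup : ∀ a b c → (a + b) + (c + 0) ≡ b + (a + c)
  regroup = solve-∀

subsetSum-by-chains : ∀ n (w : Subset n → ℕ) → subsetSum n w ≡ listSum (listSum w) (chains n)
subsetSum-by-chains zero    w = sym (trans (+-identityʳ _) (+-identityʳ _))
subsetSum-by-chains (suc n) w =
  trans (cong₂ _+_ (subsetSum-by-chains n (λ S → w (out S))) (subsetSum-by-chains n (λ S → w (ins S))))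
        (sym (concatMap-sum (chains n)))
  where
  concatMap-sum : ∀ cs → listSum (listSum w) (concatMap split cs)
    ≡ listSum (listSum (λ S → w (out S))) cs + listSum (listSum (λ S → w (ins S))) cs
  concatMap-sum []       = refl
  concatMap-sum (c ∷ cs) =
    trans (listSum-++ (listSum w) (split c) (concatMap split cs))
          (trans (cong₂ _+_ (split-sum w c) (concatMap-sum cs))
                 (interchange (listSum (λ S → w (out S)) c) (listSum (λ S → w (ins S)) c) _ _))

-- levels i l: the sizes l+i-1, …, i+1, i of a saturated chain with l
-- members whose bottom lies at level i.
levels : ℕ → ℕ → List ℕ
levels i zero    = []
levels i (suc l) = (l + i) ∷ levels i l

levels-suc : ∀ i l → map suc (levels i l) ≡ levels (suc i) l
levels-suc i zero    = refl
levels-suc i (suc l) = cong₂ _∷_ (sym (+-suc l i)) (levels-suc i l)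

-- A list of sizes is balanced (for ground set size n) if it is empty or
-- fills the consecutive levels from i up to l+i with bottom + top = n,
-- i.e. symmetrically about n/2.
Balanced : ℕ → List ℕ → Set
Balanced n []              = ⊤
Balanced n sizes@(_ ∷ _) = ∃[ i ] ∃[ l ] (sizes ≡ levels i (suc l) × i + (l + i) ≡ n)

SymmetricChain : (n : ℕ) → List (Subset n) → Set
SymmetricChain n c = AllPairs _⊐_ c × Balanced n (map ∣_∣ c)

sizes-out : ∀ {n} (c : List (Subset n)) → map ∣_∣ (map out c) ≡ map ∣_∣ c
sizes-out []      = refl
sizes-out (x ∷ c) = cong (∣ x ∣ ∷_) (sizes-out c)

sizes-ins : ∀ {n} (c : List (Subset n)) → map ∣_∣ (map ins c) ≡ map suc (map ∣_∣ c)
sizes-ins []      = refl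
sizes-ins (x ∷ c) = cong (suc ∣ x ∣ ∷_) (sizes-ins c)

shifted-balanced : ∀ {n} i l → i + (l + i) ≡ n → Balanced (suc n) (map suc (levels i l))
shifted-balanced i zero    _   = tt
shifted-balanced i (suc l) bal = suc i , l , levels-suc i (suc l) , trans (regroup i l) (cong suc bal)
  where
  regroup : ∀ i l → suc i + (l + suc i) ≡ suc (i + (suc l + i))
  regroup = solve-∀

split-symmetric : ∀ {n c} → SymmetricChain n c → All (SymmetricChain (suc n)) (split c)
split-symmetric {c = []}    _ = []
split-symmetric {c = t ∷ r} (t⊐r ∷ desc , i , l , sizes , bal) =
  (ins-top-⊐ ∷ AllPairs.map⁺ (AllPairs.map out-⊐ (t⊐r ∷ desc)) ,
   i , suc l , cong₂ _∷_ (cong suc (∷-injectiveˡ sizes)) (trans (sizes-out (t ∷ r)) sizes) ,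
   trans (+-suc i (l + i)) (cong suc bal))
  ∷ (AllPairs.map⁺ (AllPairs.map ins-⊐ desc) ,
     subst (Balanced _) (sym (trans (sizes-ins r) (cong (map suc) (∷-injectiveʳ sizes))))
           (shifted-balanced i l bal))
  ∷ []
  where
  out-⊐ : ∀ {x y} → x ⊐ y → out x ⊐ out y
  out-⊐ (y⊆x , ∣y∣<∣x∣) = (λ {z} → out⊆ y⊆x {z}) , ∣y∣<∣x∣
  ins-⊐ : ∀ {x y} → x ⊐ y → ins x ⊐ ins y
  ins-⊐ (y⊆x , ∣y∣<∣x∣) = (λ {z} → s⊆s y⊆x {z}) , s≤s ∣y∣<∣x∣
  ins-top-⊐ : All (ins t ⊐_) (map out (t ∷ r))
  ins-top-⊐ = All-map⁺ (((λ {z} → out⊆ id {z}) , n<1+n ∣ t ∣) ∷ All.map below-ins t⊐r)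
    where
    below-ins : ∀ {x} → t ⊐ x → ins t ⊐ out x
    below-ins (x⊆t , ∣x∣<∣t∣) = (λ {z} → out⊆ x⊆t {z}) , m≤n⇒m≤1+n ∣x∣<∣t∣

chains-symmetric : ∀ n → All (SymmetricChain n) (chains n)
chains-symmetric zero    = ([] ∷ [] , 0 , 0 , refl , refl) ∷ []
chains-symmetric (suc n) = concat⁺ (All-map⁺ (All.map split-symmetric (chains-symmetric n)))

levels-count-above : ∀ i l m → l + i ≤ m → listSum (λ j → δ j m) (levels i l) ≡ 0
levels-count-above i zero    m _     = refl
levels-count-above i (suc l) m l+i<m =
  cong₂ _+_ (δ-≢ (<⇒≢ l+i<m)) (levels-count-above i l m (≤-trans (n≤1+n _) l+i<m))

levels-count-within : ∀ i l m → i ≤ m → m < l + i → listSum (λ j → δ j m) (levels i l) ≡ 1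
levels-count-within i zero    m i≤m m<i = ⊥-elim (<⇒≱ m<i i≤m)
levels-count-within i (suc l) m i≤m m<top with m ≟ l + i
... | yes refl = cong₂ _+_ (δ-refl (l + i)) (levels-count-above i l (l + i) ≤-refl)
... | no m≢l+i =
  cong₂ _+_ (δ-≢ (≢-sym m≢l+i)) (levels-count-within i l m i≤m (≤∧≢⇒< (≤-pred m<top) m≢l+i))

halve : ∀ a b → a + a ≤ suc (b + b) → a ≤ b
halve zero    b       _ = z≤n
halve (suc a) zero    (s≤s a+1+a≤0) = ⊥-elim (<⇒≱ (s≤s z≤n) (subst (_≤ 0) (+-suc a a) a+1+a≤0))
halve (suc a) (suc b) (s≤s h) =
  s≤s (halve a b (≤-pred (subst₂ _≤_ (+-suc a a) (cong suc (+-suc b b)) h)))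

half-bounds : ∀ n → n / 2 + n / 2 ≤ n × n ≤ suc (n / 2 + n / 2)
half-bounds n = ≤-trans (m≤n+m (k + k) (n % 2)) (≤-reflexive (sym n≡r+2k)) ,
                ≤-trans (≤-reflexive n≡r+2k) (+-monoˡ-≤ (k + k) (≤-pred (m%n<n n 2)))
  where
  k = n / 2
  n≡r+2k : n ≡ n % 2 + (k + k)
  n≡r+2k = trans (m≡m%n+[m/n]*n n 2) (cong (n % 2 +_) (double k))
    where
    double : ∀ k → k * 2 ≡ k + k
    double = solve-∀

middle-within-chain : ∀ n i l → i + (l + i) ≡ n →
  i ≤ n / 2 × n / 2 ≤ l + i × (1 ≤ l → suc (n / 2) ≤ l + i)
middle-within-chain n i l bal = bottom≤k , k≤top , λ 1≤l → halve (suc k) (l + i) (k+1≤top 1≤l)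
  where
  open ≤-Reasoning
  k = n / 2
  bottom≤k : i ≤ k
  bottom≤k = halve i k (begin
    i + i        ≤⟨ +-monoʳ-≤ i (m≤n+m i l) ⟩
    i + (l + i)  ≡⟨ bal ⟩
    n            ≤⟨ proj₂ (half-bounds n) ⟩
    suc (k + k)  ∎)
  k≤top : k ≤ l + i
  k≤top = halve k (l + i) (begin
    k + k                    ≤⟨ proj₁ (half-bounds n) ⟩
    n                        ≡⟨ sym bal ⟩
    i + (l + i)              ≤⟨ +-monoˡ-≤ (l + i) (m≤n+m i l) ⟩
    (l + i) + (l + i)        ≤⟨ n≤1+n _ ⟩
    suc ((l + i) + (l + i))  ∎)
  k+1≤top : 1 ≤ l → suc k + suc k ≤ suc ((l + i) + (l + i))
  k+1≤top 1≤l = begin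
    suc k + suc k            ≡⟨ cong suc (+-suc k k) ⟩
    suc (suc (k + k))        ≤⟨ s≤s (s≤s (proj₁ (half-bounds n))) ⟩
    suc (1 + n)              ≤⟨ s≤s (+-monoˡ-≤ n 1≤l) ⟩
    suc (l + n)              ≡⟨ cong (λ m → suc (l + m)) (sym bal) ⟩
    suc (l + (i + (l + i)))  ≡⟨ cong suc (sym (+-assoc l i (l + i))) ⟩
    suc ((l + i) + (l + i))  ∎

onLevel : ∀ {n} → ℕ → List (Subset n) → ℕ
onLevel m c = listSum (λ S → δ (∣ S ∣) m) c

onLevel-levels : ∀ {n} m (c : List (Subset n)) {sizes} → map ∣_∣ c ≡ sizes →
  onLevel m c ≡ listSum (λ j → δ j m) sizes
onLevel-levels m c refl = sym (listSum-map (λ j → δ j m) ∣_∣ c)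

onLevel-middle : ∀ {n} t (r : List (Subset n)) → Balanced n (map ∣_∣ (t ∷ r)) →
  onLevel (n / 2) (t ∷ r) ≡ 1
onLevel-middle {n} t r (i , l , sizes , bal) =
  trans (onLevel-levels (n / 2) (t ∷ r) sizes)
        (levels-count-within i (suc l) (n / 2) bottom≤k (s≤s k≤top))
  where
  bottom≤k = proj₁ (middle-within-chain n i l bal)
  k≤top    = proj₁ (proj₂ (middle-within-chain n i l bal))

onLevel-above-middle : ∀ {n} t u (r : List (Subset n)) → Balanced n (map ∣_∣ (t ∷ u ∷ r)) →
  onLevel (suc (n / 2)) (t ∷ u ∷ r) ≡ 1
onLevel-above-middle {n} t u r (i , zero , sizes , bal) with ∷-injectiveʳ sizes
... | ()
onLevel-above-middle {n} t u r (i , suc l , sizes , bal) =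
  trans (onLevel-levels (suc (n / 2)) (t ∷ u ∷ r) sizes)
        (levels-count-within i (suc (suc l)) (suc (n / 2))
          (m≤n⇒m≤1+n bottom≤k) (s≤s (k+1≤top (s≤s z≤n))))
  where
  bottom≤k = proj₁ (middle-within-chain n i (suc l) bal)
  k+1≤top  = proj₂ (proj₂ (middle-within-chain n i (suc l) bal))

familyWeight : ∀ {n} → List (Subset n) → List (Subset n) → Subset n → ℕ
familyWeight 𝒜 L S = mult S 𝒜 + mult S 𝒜 + mult S L

levelWeight : ∀ {n} → ℕ → Subset n → ℕ
levelWeight k S = δ (∣ S ∣) k + δ (∣ S ∣) k + δ (∣ S ∣) (suc k)

Disjoint : ∀ {n} → List (Subset n) → List (Subset n) → Set
Disjoint 𝒜 L = ∀ {S} → S ∈ 𝒜 → S ∉ L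

-- The arithmetic of the per-chain bound: a chain meeting 𝒜 a times and L
-- b times (each at most once) has weight 2a + b ≤ 2 + e, provided it meets
-- 𝒜 ∪ L at most once in total or has e ≥ 1 members above the middle level.
chain-weight-arith : ∀ {a b e} → a ≤ 1 → b ≤ 1 → (a + b ≤ 1 ⊎ 1 ≤ e) → a + a + b ≤ 1 + 1 + e
chain-weight-arith {a} {b} {e} a≤1 b≤1 (inj₁ a+b≤1) =
  ≤-trans (≤-reflexive (+-assoc a a b)) (≤-trans (+-mono-≤ a≤1 a+b≤1) (m≤m+n 2 e))
chain-weight-arith a≤1 b≤1 (inj₂ 1≤e) =
  +-mono-≤ (+-mono-≤ a≤1 a≤1) (≤-trans b≤1 1≤e)

meets-once-or-crosses : ∀ {n} (𝒜 L : List (Subset n)) → Disjoint 𝒜 L →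
  ∀ t r → Balanced n (map ∣_∣ (t ∷ r)) →
  listSum (λ S → mult S 𝒜) (t ∷ r) ≤ 1 → listSum (λ S → mult S L) (t ∷ r) ≤ 1 →
  listSum (λ S → mult S 𝒜) (t ∷ r) + listSum (λ S → mult S L) (t ∷ r) ≤ 1
    ⊎ 1 ≤ onLevel (suc (n / 2)) (t ∷ r)
meets-once-or-crosses 𝒜 L disjoint t [] _ a≤1 b≤1 with t ∈? 𝒜
... | yes t∈𝒜 = inj₁ (begin
    (mult t 𝒜 + 0) + (mult t L + 0)  ≡⟨ cong (λ b → (mult t 𝒜 + 0) + (b + 0)) (mult-∉ t L (disjoint t∈𝒜)) ⟩
    (mult t 𝒜 + 0) + 0               ≡⟨ +-identityʳ _ ⟩
    mult t 𝒜 + 0                     ≤⟨ a≤1 ⟩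
    1                                ∎)
  where open ≤-Reasoning
... | no t∉𝒜 = inj₁ (begin
    (mult t 𝒜 + 0) + (mult t L + 0)  ≡⟨ cong (λ a → (a + 0) + (mult t L + 0)) (mult-∉ t 𝒜 t∉𝒜) ⟩
    mult t L + 0                     ≤⟨ b≤1 ⟩
    1                                ∎)
  where open ≤-Reasoning
meets-once-or-crosses 𝒜 L disjoint t (u ∷ r) bal _ _ =
  inj₂ (≤-reflexive (sym (onLevel-above-middle t u r bal)))

chain-bound : ∀ {n} (𝒜 L : List (Subset n)) → Disjoint 𝒜 L →
  ∀ c → Balanced n (map ∣_∣ c) →
  listSum (λ S → mult S 𝒜) c ≤ 1 → listSum (λ S → mult S L) c ≤ 1 →
  listSum (familyWeight 𝒜 L) c ≤ listSum (levelWeight (n / 2)) c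
chain-bound 𝒜 L disjoint [] _ _ _ = z≤n
chain-bound {n} 𝒜 L disjoint (t ∷ r) bal a≤1 b≤1 = begin
    listSum (familyWeight 𝒜 L) (t ∷ r)
  ≡⟨ listSum-double-plus (λ S → mult S 𝒜) (λ S → mult S L) (t ∷ r) ⟩
    a + a + b
  ≤⟨ chain-weight-arith a≤1 b≤1 (meets-once-or-crosses 𝒜 L disjoint t r bal a≤1 b≤1) ⟩
    1 + 1 + onLevel (suc k) (t ∷ r)
  ≡⟨ cong (λ h → h + h + onLevel (suc k) (t ∷ r)) (sym (onLevel-middle t r bal)) ⟩
    onLevel k (t ∷ r) + onLevel k (t ∷ r) + onLevel (suc k) (t ∷ r)
  ≡⟨ sym (listSum-double-plus (λ S → δ (∣ S ∣) k) (λ S → δ (∣ S ∣) (suc k)) (t ∷ r)) ⟩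
    listSum (levelWeight k) (t ∷ r)
  ∎
  where
  open ≤-Reasoning
  k = n / 2
  a = listSum (λ S → mult S 𝒜) (t ∷ r)
  b = listSum (λ S → mult S L) (t ∷ r)

-- No member of an antichain lies in its shade (the shade is one level up).
antichain-shade-disjoint : ∀ {n} {𝒜 : List (Subset n)} {S} → Incomparable 𝒜 → S ∈ 𝒜 → ¬ (S ∈∇ 𝒜)
antichain-shade-disjoint inc S∈𝒜 (A , A∈𝒜 , A⊆S , ∣S∣≡1+∣A∣) with inc A∈𝒜 S∈𝒜 A⊆S
... | refl = 1+n≢n (sym ∣S∣≡1+∣A∣)

minShade-incomparable : ∀ {n} {𝒜 L : List (Subset n)} → EnumeratesMinShade 𝒜 L → Incomparable L
minShade-incomparable enum B∈L B′∈L B⊆B′ =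
  proj₂ (EnumeratesMinShade.sound enum B′∈L) _ (proj₁ (EnumeratesMinShade.sound enum B∈L)) B⊆B′

upper-bound : ∀ n (𝒜 L : List (Subset n)) → IsAntichain 𝒜 → EnumeratesMinShade 𝒜 L →
  2 * length 𝒜 + length L ≤ 2 * (n C (n / 2)) + (n C suc (n / 2))
upper-bound n 𝒜 L anti enum = begin
    2 * length 𝒜 + length L
  ≡⟨ double-plus (length 𝒜) (length L) ⟩
    length 𝒜 + length 𝒜 + length L
  ≡⟨ sym (trans (subsetSum-double-plus n (λ S → mult S 𝒜) (λ S → mult S L))
                (cong₂ (λ a b → a + a + b) (mult-total n 𝒜) (mult-total n L))) ⟩
    subsetSum n (familyWeight 𝒜 L)
  ≡⟨ subsetSum-by-chains n (familyWeight 𝒜 L) ⟩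
    listSum (listSum (familyWeight 𝒜 L)) (chains n)
  ≤⟨ listSum-mono _ _ (chains n) (All.map bound-on-chain (chains-symmetric n)) ⟩
    listSum (listSum (levelWeight k)) (chains n)
  ≡⟨ sym (subsetSum-by-chains n (levelWeight k)) ⟩
    subsetSum n (levelWeight k)
  ≡⟨ trans (subsetSum-double-plus n (λ S → δ (∣ S ∣) k) (λ S → δ (∣ S ∣) (suc k)))
           (cong₂ (λ a b → a + a + b) (count-level n k) (count-level n (suc k))) ⟩
    n C k + n C k + n C suc k
  ≡⟨ sym (double-plus (n C k) (n C suc k)) ⟩
    2 * (n C k) + (n C suc k)
  ∎
  where
  open ≤-Reasoning
  open IsAntichain anti
  k = n / 2
  bound-on-chain : ∀ {c} → SymmetricChain n c →
    listSum (familyWeight 𝒜 L) c ≤ listSum (levelWeight k) c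
  bound-on-chain {c} (desc , bal) =
    chain-bound 𝒜 L (λ S∈𝒜 S∈L → antichain-shade-disjoint incomparable S∈𝒜
                                    (proj₁ (EnumeratesMinShade.sound enum S∈L)))
                c bal
                (chain-meets-antichain noDup incomparable desc)
                (chain-meets-antichain (EnumeratesMinShade.noDup enum) (minShade-incomparable enum) desc)

layer : (n j : ℕ) → List (Subset n)
layer zero    zero    = [] ∷ []
layer zero    (suc j) = []
layer (suc n) zero    = map out (layer n zero)
layer (suc n) (suc j) = map out (layer n (suc j)) ++ map ins (layer n j)

layer-length : ∀ n j → length (layer n j) ≡ n C j
layer-length zero    zero    = refl
layer-length zero    (suc j) = refl
layer-length (suc n) zero    = trans (length-map out (layer n zero)) (layer-length n zero)
layer-length (suc n) (suc j) = begin
    length (map out (layer n (suc j)) ++ map ins (layer n j))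
  ≡⟨ length-++ (map out (layer n (suc j))) ⟩
    length (map out (layer n (suc j))) + length (map ins (layer n j))
  ≡⟨ cong₂ _+_ (length-map out (layer n (suc j))) (length-map ins (layer n j)) ⟩
    length (layer n (suc j)) + length (layer n j)
  ≡⟨ cong₂ _+_ (layer-length n (suc j)) (layer-length n j) ⟩
    n C suc j + n C j
  ≡⟨ +-comm (n C suc j) (n C j) ⟩
    n C j + n C suc j
  ≡⟨ nCk+nC[k+1]≡[n+1]C[k+1] n j ⟩
    suc n C suc j
  ∎
  where open ≡-Reasoning

∈-layer⁻ : ∀ n j {S} → S ∈ layer n j → ∣ S ∣ ≡ j
∈-layer⁻ zero    zero    (here refl) = refl
∈-layer⁻ (suc n) zero    S∈ with ∈-map⁻ out S∈
... | _ , S′∈ , refl = ∈-layer⁻ n zero S′∈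
∈-layer⁻ (suc n) (suc j) S∈ with ∈-++⁻ (map out (layer n (suc j))) S∈
... | inj₁ S∈outs with ∈-map⁻ out S∈outs
...   | _ , S′∈ , refl = ∈-layer⁻ n (suc j) S′∈
∈-layer⁻ (suc n) (suc j) S∈ | inj₂ S∈inss with ∈-map⁻ ins S∈inss
...   | _ , S′∈ , refl = cong suc (∈-layer⁻ n j S′∈)

∈-layer⁺ : ∀ n j (S : Subset n) → ∣ S ∣ ≡ j → S ∈ layer n j
∈-layer⁺ zero    zero    []            _  = here refl
∈-layer⁺ (suc n) zero    (outside ∷ S) eq = ∈-map⁺ out (∈-layer⁺ n zero S eq)
∈-layer⁺ (suc n) (suc j) (outside ∷ S) eq = ∈-++⁺ˡ (∈-map⁺ out (∈-layer⁺ n (suc j) S eq))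
∈-layer⁺ (suc n) (suc j) (inside ∷ S)  eq =
  ∈-++⁺ʳ (map out (layer n (suc j))) (∈-map⁺ ins (∈-layer⁺ n j S (suc-injective eq)))

layer-unique : ∀ n j → Unique (layer n j)
layer-unique zero    zero    = [] ∷ []
layer-unique zero    (suc j) = []
layer-unique (suc n) zero    = Unique.map⁺ out-injective (layer-unique n zero)
  where
  out-injective : ∀ {x y : Subset n} → out x ≡ out y → x ≡ y
  out-injective refl = refl
layer-unique (suc n) (suc j) =
  Unique.++⁺ (Unique.map⁺ out-injective (layer-unique n (suc j)))
             (Unique.map⁺ ins-injective (layer-unique n j))
             outs-disjoint-inss
  where
  out-injective : ∀ {x y : Subset n} → out x ≡ out y → x ≡ y
  out-injective refl = refl
  ins-injective : ∀ {x y : Subset n} → ins x ≡ ins y → x ≡ y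
  ins-injective refl = refl
  outs-disjoint-inss : ∀ {S} → ¬ (S ∈ map out (layer n (suc j)) × S ∈ map ins (layer n j))
  outs-disjoint-inss (S∈outs , S∈inss) with ∈-map⁻ out S∈outs | ∈-map⁻ ins S∈inss
  ... | _ , _ , refl | _ , _ , ()

⊆-same-size : ∀ {n} {A B : Subset n} → A ⊆ B → ∣ A ∣ ≡ ∣ B ∣ → A ≡ B
⊆-same-size {A = []}          {[]}          _   _  = refl
⊆-same-size {A = inside ∷ A}  {inside ∷ B}  A⊆B eq =
  cong (inside ∷_) (⊆-same-size (drop-∷-⊆ A⊆B) (suc-injective eq))
⊆-same-size {A = outside ∷ A} {outside ∷ B} A⊆B eq =
  cong (outside ∷_) (⊆-same-size (drop-∷-⊆ A⊆B) eq)
⊆-same-size {A = inside ∷ A}  {outside ∷ B} A⊆B eq with A⊆B vhere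
... | ()
⊆-same-size {A = outside ∷ A} {inside ∷ B}  A⊆B eq =
  ⊥-elim (<-irrefl eq (s≤s (p⊆q⇒∣p∣≤∣q∣ (drop-∷-⊆ A⊆B))))

drop-one : ∀ {n} (B : Subset n) j → ∣ B ∣ ≡ suc j → ∃[ A ] (A ⊆ B × ∣ A ∣ ≡ j)
drop-one (inside ∷ B)  j eq = outside ∷ B , (λ {z} → out⊆ id {z}) , suc-injective eq
drop-one (outside ∷ B) j eq with drop-one B j eq
... | A , A⊆B , eq′ = outside ∷ A , (λ {z} → out⊆ A⊆B {z}) , eq′

some-subset-of-size : ∀ n j → j ≤ n → Σ (Subset n) λ S → ∣ S ∣ ≡ j
some-subset-of-size zero    zero    _       = [] , refl
some-subset-of-size (suc n) zero    _ with some-subset-of-size n zero z≤n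
... | S , ∣S∣≡0 = outside ∷ S , ∣S∣≡0
some-subset-of-size (suc n) (suc j) (s≤s j≤n) with some-subset-of-size n j j≤n
... | S , ∣S∣≡j = inside ∷ S , cong suc ∣S∣≡j

layer-antichain : ∀ n j → j ≤ n → IsAntichain (layer n j)
layer-antichain n j j≤n = record
  { nonEmpty     = λ layer≡[] → case some-subset-of-size n j j≤n of λ
      { (S , ∣S∣≡j) → case subst (S ∈_) layer≡[] (∈-layer⁺ n j S ∣S∣≡j) of λ () }
  ; noDup        = layer-unique n j
  ; incomparable = λ A∈ B∈ A⊆B → ⊆-same-size A⊆B (trans (∈-layer⁻ n j A∈) (sym (∈-layer⁻ n j B∈)))
  }

-- The shade of layer j is layer j + 1; all its members have the same size,
-- so all are minimal.
layer-minShade : ∀ n j → EnumeratesMinShade (layer n j) (layer n (suc j))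
layer-minShade n j = record
  { noDup    = layer-unique n (suc j)
  ; sound    = sound
  ; complete = λ (B∈∇ , _) → ∈-layer⁺ n (suc j) _ (in-shade-size B∈∇)
  }
  where
  in-shade-size : ∀ {C} → C ∈∇ layer n j → ∣ C ∣ ≡ suc j
  in-shade-size (A , A∈ , _ , ∣C∣≡1+∣A∣) = trans ∣C∣≡1+∣A∣ (cong suc (∈-layer⁻ n j A∈))
  sound : ∀ {B} → B ∈ layer n (suc j) → B ∈min∇ layer n j
  sound {B} B∈ with drop-one B j (∈-layer⁻ n (suc j) B∈)
  ... | A , A⊆B , ∣A∣≡j =
    (A , ∈-layer⁺ n j A ∣A∣≡j , A⊆B , trans (∈-layer⁻ n (suc j) B∈) (cong suc (sym ∣A∣≡j))) ,
    λ C C∈∇ C⊆B → ⊆-same-size C⊆B (trans (in-shade-size C∈∇) (sym (∈-layer⁻ n (suc j) B∈)))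

middle-layer-extremal : ∀ n → Σ (List (Subset n)) λ 𝒜 → Σ (List (Subset n)) λ L →
  (IsAntichain 𝒜 × EnumeratesMinShade 𝒜 L ×
   2 * length 𝒜 + length L ≡ 2 * (n C (n / 2)) + (n C suc (n / 2)))
middle-layer-extremal n =
  layer n k , layer n (suc k) , layer-antichain n k (m/n≤m n 2) , layer-minShade n k ,
  cong₂ (λ a b → 2 * a + b) (layer-length n k) (layer-length n (suc k))
  where
  k = n / 2

theorem6p8 : (n : ℕ) → 1 ≤ n →
    ((𝒜 L : List (Subset n)) → IsAntichain 𝒜 → EnumeratesMinShade 𝒜 L →
      2 * length 𝒜 + length L ≤ 2 * (n C (n / 2)) + (n C suc (n / 2)))
    × (Σ (List (Subset n)) λ 𝒜 → Σ (List (Subset n)) λ L → (IsAntichain 𝒜 × EnumeratesMinShade 𝒜 L ×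
      2 * length 𝒜 + length L ≡ 2 * (n C (n / 2)) + (n C suc (n / 2))))
theorem6p8 n _ = upper-bound n , middle-layer-extremal n
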